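{- Let $n=2k+1\ge5$ and let $\tilde{\mathbf{D}}_n$ be the simply-laced tree on vertices $0,1,\dots,n$ with edges $1-2$, $0-2$, $2-3,\dots,(n-3)-(n-2)$, $(n-2)-(n-1)$ and $(n-2)-n$. Then $\tilde{\mathbf{D}}_n$ has exactly $k+4=(n-1)/2+4$ equivalence classes of labelings.
   Context: Reeder's puzzle on a finite connected simple graph: a labeling assigns $a_j\in\mathbb{Z}/2\mathbb{Z}$ to each vertex $j$; the move $T_i$ replaces $a_i$ by $a_i+\sum_k a_k \pmod 2$ (sum over neighbors $k$ of $i$), other labels unchanged. Two labelings are equivalent if related by a finite sequence of moves. -}

module Defs where

open import Data.Bool using (Bool; true; false; _∧_; _∨_; _xor_)
open import Data.Nat using (ℕ; zero; suc; _+_; _*_; _∸_; _≡ᵇ_; _≤ᵇ_)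
open import Data.Fin using (Fin; toℕ)
open import Data.List using (List; foldr; allFin)
open import Data.Vec using (Vec; lookup; _[_]≔_)
open import Data.Product using (Σ; ∃; _×_)
open import Relation.Binary.PropositionalEquality using (_≡_)
open import Relation.Binary.Construct.Closure.ReflexiveTransitive using (Star)

record Graph (m : ℕ) : Set where
  field
    adj : Fin m → Fin m → Bool

open Graph public

-- Labelings: an element of Z/2Z (encoded as Bool, addition = xor) at each vertex.
Labeling : ℕ → Set
Labeling m = Vec Bool m

neighbourSum : ∀ {m} → Graph m → Labeling m → Fin m → Bool
neighbourSum G a i = foldr (λ j s → (adj G i j ∧ lookup a j) xor s) false (allFin _)

move : ∀ {m} → Graph m → Fin m → Labeling m → Labeling m
move G i a = a [ i ]≔ (lookup a i xor neighbourSum G a i)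

Step : ∀ {m} → Graph m → Labeling m → Labeling m → Set
Step G a b = ∃ λ i → b ≡ move G i a

Equiv : ∀ {m} → Graph m → Labeling m → Labeling m → Set
Equiv G = Star (Step G)

-- The set of equivalence classes has exactly c elements:
-- a surjection onto Fin c whose fibres are exactly the equivalence classes.
HasExactlyClasses : ∀ {m} → Graph m → ℕ → Set
HasExactlyClasses {m} G c =
  Σ (Labeling m → Fin c) λ f →
    (∀ (y : Fin c) → ∃ λ a → f a ≡ y) ×
    (∀ a b → (f a ≡ f b → Equiv G a b) × (Equiv G a b → f a ≡ f b))

DEdge : ℕ → ℕ → ℕ → Bool
DEdge n a b =
  ((a ≡ᵇ 1) ∧ (b ≡ᵇ 2)) ∨
  ((a ≡ᵇ 0) ∧ (b ≡ᵇ 2)) ∨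
  ((2 ≤ᵇ a) ∧ (a ≤ᵇ (n ∸ 3)) ∧ (b ≡ᵇ suc a)) ∨
  ((a ≡ᵇ (n ∸ 2)) ∧ (b ≡ᵇ (n ∸ 1))) ∨
  ((a ≡ᵇ (n ∸ 2)) ∧ (b ≡ᵇ n))

Dtilde : (n : ℕ) → Graph (suc n)
Dtilde n = record { adj = λ i j → DEdge n (toℕ i) (toℕ j) ∨ DEdge n (toℕ j) (toℕ i) }

module Submission where

-- Place the vertices of D̃ₙ at positions 0, 0, 1, 2, …, n − 3, n − 2, n − 2 (the two leaves at either end
-- share a position): two vertices are adjacent exactly when their positions differ by one.  Let C j (j < n)
-- be the sum of the labels at positions j − 1 and j.  Together with the corner labels a₀ and aₙ these
-- coordinates determine the labeling, and every C with an even number of ones occurs.  The move at a vertex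
-- of position p adds C p + C (p + 1) to its label, which swaps C p and C (p + 1); only the moves at 0 and n
-- change a corner label.  So the weight of C (its number of ones, always even) is invariant.  In weight 0
-- every move is trivial, giving 4 singleton classes.  In each weight 2, 4, …, n − 1 the inner moves permute
-- C arbitrarily and the corner moves set both corner labels at will, so each of these (n − 1)/2 weights is
-- a single class.

open import Defs
open import Level using (0ℓ)
open import Function using (id; _∘_; _⇔_; mk⇔; Equivalence)
open import Data.Bool.Base using (Bool; true; false; _∧_; _∨_; _xor_; not; T; if_then_else_)
open import Data.Bool.Properties
  using (xor-∧-commutativeRing; xor-identityʳ; ∧-zeroʳ; xor-same; T-≡; T-∧; T-∨)
  renaming (_≟_ to _≟ᴮ_)
open import Data.Nat.Base
  using (ℕ; zero; suc; _+_; _*_; _∸_; _≤_; _<_; _≡ᵇ_; _≤ᵇ_; ⌊_/2⌋; z≤n; s≤s; z<s; s<s)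
open import Data.Nat.Properties
  using ( _≟_; suc-injective; 0≢1+n; n≢0⇒n>0; +-suc; +-cancelˡ-≡; +-mono-≤; m≤m+n; m∸n+n≡m
        ; ∸-monoʳ-≤; ≡ᵇ⇒≡; ≡⇒≡ᵇ; ≤ᵇ⇒≤; ≤⇒≤ᵇ; ≤-refl; ≤-reflexive; ≤-trans; ≤-antisym; ≤-pred
        ; n≤1+n; m≤n⇒m≤1+n; <-irrefl; <-trans; <-cmp; <⇒≤; <⇒≢; n<1+n; m<n⇒m<1+n; ≤∧≢⇒<
        ; m≤n⇒m<n∨m≡n; n≮n; m+n≮n; 1+n≰n; ⌊n/2⌋-mono; n≡⌊n+n/2⌋ )
open import Data.Fin.Base using (Fin; toℕ; fromℕ<; fromℕ) renaming (zero to fzero; suc to fsuc)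
import Data.Fin.Properties as Fin
open import Data.List.Base
  using (List; []; _∷_; _++_; replicate; foldr; map; length; applyUpTo; tabulate; allFin)
open import Data.List.Properties using (∷-injective; foldr-cong; length-applyUpTo)
open import Data.List.Membership.Propositional using (_∈_)
open import Data.List.Membership.Propositional.Properties using (∉[])
open import Data.List.Relation.Unary.Any using (here; there)
open import Data.List.Relation.Unary.All using (All; []; _∷_)
import Data.List.Relation.Unary.All as All
open import Data.List.Relation.Unary.All.Properties using (All¬⇒¬Any)
open import Data.List.Relation.Unary.AllPairs using ([]; _∷_)
open import Data.List.Relation.Unary.Unique.Propositional using (Unique)
open import Data.Vec.Base using (Vec; []; _∷_; lookup; _[_]≔_)
import Data.Vec.Base as Vec
open import Data.Vec.Properties using (lookup∘update; lookup∘update′; []≔-idempotent; []≔-lookup)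
open import Data.Maybe.Base using (just; nothing)
open import Data.Product using (∃; _×_; _,_; proj₁; proj₂; uncurry)
open import Data.Product.Relation.Binary.Pointwise.NonDependent using (Pointwise)
open import Data.Sum using (_⊎_; inj₁; inj₂; [_,_]′)
import Data.Sum as Sum
open import Data.Empty using (⊥-elim)
open import Relation.Nullary using (¬_; Dec; yes; no)
open import Relation.Binary.Core using (Rel)
open import Relation.Binary.Definitions using (tri<; tri≈; tri>)
open import Relation.Binary.PropositionalEquality
  using (_≡_; _≢_; refl; sym; trans; cong; cong₂; subst; subst₂; module ≡-Reasoning)
open import Relation.Binary.Construct.Closure.ReflexiveTransitive
  using (Star; ε; _◅_; _◅◅_; gmap; reverse)
open import Tactic.RingSolver.Core.AlmostCommutativeRing using (AlmostCommutativeRing; fromCommutativeRing)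
open import Tactic.RingSolver using (solve-∀)
open import Data.Nat.Tactic.RingSolver using () renaming (solve-∀ to ℕ-solve-∀)

open Equivalence using (to; from)

-- Sums in ℤ/2

bool-ring : AlmostCommutativeRing 0ℓ 0ℓ
bool-ring = fromCommutativeRing xor-∧-commutativeRing λ where
  false → just refl
  true  → nothing

¬T⇒≡false : ∀ {b} → ¬ T b → b ≡ false
¬T⇒≡false {false} _ = refl
¬T⇒≡false {true}  t = ⊥-elim (t _)

≡ᵇ-refl : ∀ p → (p ≡ᵇ p) ≡ true
≡ᵇ-refl zero    = refl
≡ᵇ-refl (suc p) = ≡ᵇ-refl p

≢⇒≡ᵇ-false : ∀ {w p} → w ≢ p → (w ≡ᵇ p) ≡ false
≢⇒≡ᵇ-false {w} {p} w≢p = ¬T⇒≡false (w≢p ∘ ≡ᵇ⇒≡ w p)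

≢⇒xor-true : ∀ {x y} → x ≢ y → x xor y ≡ true
≢⇒xor-true {false} {false} x≢y = ⊥-elim (x≢y refl)
≢⇒xor-true {false} {true}  _   = refl
≢⇒xor-true {true}  {false} _   = refl
≢⇒xor-true {true}  {true}  x≢y = ⊥-elim (x≢y refl)

xor-∧-false : ∀ x y → x xor (y ∧ false) ≡ x
xor-∧-false x y = trans (cong (x xor_) (∧-zeroʳ y)) (xor-identityʳ x)

xor-cancelˡ : ∀ a {b c} → a xor b ≡ a xor c → b ≡ c
xor-cancelˡ a {b} {c} eq = trans (sym (cancel a b)) (trans (cong (a xor_) eq) (cancel a c))
  where
  cancel : ∀ a b → a xor (a xor b) ≡ b
  cancel = solve-∀ bool-ring

parity : List Bool → Bool
parity = foldr _xor_ false

⊕[_]_ : ℕ → (ℕ → Bool) → Bool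
⊕[ k ] f = parity (applyUpTo f k)

module _ {A : Set} where

  applyUpTo-cong : ∀ k {f g : ℕ → A} → (∀ w → w < k → f w ≡ g w) → applyUpTo f k ≡ applyUpTo g k
  applyUpTo-cong zero    _   = refl
  applyUpTo-cong (suc k) f≗g = cong₂ _∷_ (f≗g 0 z<s) (applyUpTo-cong k λ w w<k → f≗g (suc w) (s<s w<k))

  applyUpTo-injective : ∀ k {f g : ℕ → A} → applyUpTo f k ≡ applyUpTo g k → ∀ w → w < k → f w ≡ g w
  applyUpTo-injective (suc k) eq zero    _         = proj₁ (∷-injective eq)
  applyUpTo-injective (suc k) eq (suc w) (s<s w<k) = applyUpTo-injective k (proj₂ (∷-injective eq)) w w<k

⊕-cong : ∀ k {f g} → (∀ w → w < k → f w ≡ g w) → ⊕[ k ] f ≡ ⊕[ k ] g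
⊕-cong k f≗g = cong parity (applyUpTo-cong k f≗g)

⊕-false : ∀ k → ⊕[ k ] (λ _ → false) ≡ false
⊕-false zero    = refl
⊕-false (suc k) = ⊕-false k

⊕-xor : ∀ k f g → ⊕[ k ] (λ w → f w xor g w) ≡ ⊕[ k ] f xor ⊕[ k ] g
⊕-xor zero    f g = refl
⊕-xor (suc k) f g = trans (cong ((f 0 xor g 0) xor_) (⊕-xor k (λ w → f (suc w)) (λ w → g (suc w))))
                          (interchange (f 0) (g 0) _ _)
  where
  interchange : ∀ a b c d → (a xor b) xor (c xor d) ≡ (a xor c) xor (b xor d)
  interchange = solve-∀ bool-ring

⊕-indicator : ∀ k p A → p < k → ⊕[ k ] (λ w → (w ≡ᵇ p) ∧ A w) ≡ A p
⊕-indicator (suc k) zero    A _         = trans (cong (A 0 xor_) (⊕-false k)) (xor-identityʳ (A 0))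
⊕-indicator (suc k) (suc p) A (s<s p<k) = ⊕-indicator k p (λ w → A (suc w)) p<k

⊕-telescope : ∀ k A → ⊕[ k ] (λ w → A w xor A (suc w)) ≡ A 0 xor A k
⊕-telescope zero    A = sym (xor-same (A 0))
⊕-telescope (suc k) A =
  trans (cong ((A 0 xor A 1) xor_) (⊕-telescope k (λ w → A (suc w)))) (cancel (A 0) (A 1) (A (suc k)))
  where
  cancel : ∀ a b c → (a xor b) xor (b xor c) ≡ a xor c
  cancel = solve-∀ bool-ring

⊕-snoc : ∀ k f → ⊕[ suc k ] f ≡ ⊕[ k ] f xor f k
⊕-snoc zero    f = xor-identityʳ (f 0)
⊕-snoc (suc k) f = trans (cong (f 0 xor_) (⊕-snoc k (λ w → f (suc w)))) (reassoc (f 0) _ _)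
  where
  reassoc : ∀ a b c → a xor (b xor c) ≡ (a xor b) xor c
  reassoc = solve-∀ bool-ring

⊕-support : ∀ k (F A : ℕ → Bool) ps → Unique ps → All (_< k) ps →
            (∀ w → T (F w) ⇔ w ∈ ps) → ⊕[ k ] (λ w → F w ∧ A w) ≡ parity (map A ps)
⊕-support k F A [] _ _ F⇔ =
  trans (⊕-cong k λ w _ → cong (_∧ A w) (¬T⇒≡false (∉[] ∘ to (F⇔ w)))) (⊕-false k)
⊕-support k F A (p ∷ ps) (p∉ps ∷ unique) (p<k ∷ bounded) F⇔ = begin
  ⊕[ k ] (λ w → F w ∧ A w)                          ≡⟨ ⊕-cong k (λ w _ → split (w ≡ᵇ p) (F w) (A w)) ⟩
  ⊕[ k ] (λ w → δ w xor (F′ w ∧ A w))               ≡⟨ ⊕-xor k δ (λ w → F′ w ∧ A w) ⟩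
  ⊕[ k ] δ xor ⊕[ k ] (λ w → F′ w ∧ A w)            ≡⟨ cong₂ _xor_ (⊕-indicator k p A p<k)
                                                                 (⊕-support k F′ A ps unique bounded F′⇔) ⟩
  A p xor parity (map A ps)                         ∎
  where
  open ≡-Reasoning
  δ F′ : ℕ → Bool
  δ w  = (w ≡ᵇ p) ∧ A w
  F′ w = (w ≡ᵇ p) xor F w
  split : ∀ d f a → f ∧ a ≡ (d ∧ a) xor ((d xor f) ∧ a)
  split = solve-∀ bool-ring
  F′⇔ : ∀ w → T (F′ w) ⇔ w ∈ ps
  F′⇔ w with w ≟ p
  ... | yes refl = mk⇔ (λ t → ⊥-elim (subst T F′p≡false t)) (λ p∈ps → ⊥-elim (All¬⇒¬Any p∉ps p∈ps))
    where
    F′p≡false : F′ p ≡ false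
    F′p≡false = cong₂ _xor_ (≡ᵇ-refl p) (to T-≡ (from (F⇔ p) (here refl)))
  ... | no w≢p = mk⇔ (λ t → drop (to (F⇔ w) (subst T F′≡F t)))
                     (λ w∈ps → subst T (sym F′≡F) (from (F⇔ w) (there w∈ps)))
    where
    F′≡F : F′ w ≡ F w
    F′≡F = cong (_xor F w) (≢⇒≡ᵇ-false w≢p)
    drop : w ∈ p ∷ ps → w ∈ ps
    drop (here w≡p)   = ⊥-elim (w≢p w≡p)
    drop (there w∈ps) = w∈ps

-- Bit lists up to adjacent transpositions

ones zeros : List Bool → ℕ
ones []           = 0
ones (true ∷ l)  = suc (ones l)
ones (false ∷ l) = ones l
zeros []           = 0
zeros (true ∷ l)  = zeros l
zeros (false ∷ l) = suc (zeros l)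

ones+zeros≡length : ∀ l → ones l + zeros l ≡ length l
ones+zeros≡length []          = refl
ones+zeros≡length (true ∷ l)  = cong suc (ones+zeros≡length l)
ones+zeros≡length (false ∷ l) = trans (+-suc (ones l) (zeros l)) (cong suc (ones+zeros≡length l))

ones≤length : ∀ l → ones l ≤ length l
ones≤length l = subst (ones l ≤_) (ones+zeros≡length l) (m≤m+n (ones l) (zeros l))

ones≡0⇒false : ∀ k (f : ℕ → Bool) → ones (applyUpTo f k) ≡ 0 → ∀ w → w < k → f w ≡ false
ones≡0⇒false (suc k) f eq w w<k with f 0 in f0
ones≡0⇒false (suc k) f () w w<k | true
ones≡0⇒false (suc k) f eq zero    _         | false = f0
ones≡0⇒false (suc k) f eq (suc w) (s<s w<k) | false = ones≡0⇒false k (λ w → f (suc w)) eq w w<k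

isOdd : ℕ → Bool
isOdd zero          = false
isOdd (suc zero)    = true
isOdd (suc (suc w)) = isOdd w

isOdd-suc : ∀ w → isOdd (suc w) ≡ not (isOdd w)
isOdd-suc zero          = refl
isOdd-suc (suc zero)    = refl
isOdd-suc (suc (suc w)) = isOdd-suc w

isOdd-double : ∀ t → isOdd (t + t) ≡ false
isOdd-double zero    = refl
isOdd-double (suc t) = trans (cong isOdd (+-suc (suc t) t)) (isOdd-double t)

even⇒⌊n/2⌋+⌊n/2⌋≡n : ∀ w → isOdd w ≡ false → ⌊ w /2⌋ + ⌊ w /2⌋ ≡ w
even⇒⌊n/2⌋+⌊n/2⌋≡n zero          _    = refl
even⇒⌊n/2⌋+⌊n/2⌋≡n (suc (suc w)) even =
  cong suc (trans (+-suc ⌊ w /2⌋ ⌊ w /2⌋) (cong suc (even⇒⌊n/2⌋+⌊n/2⌋≡n w even)))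

parity≡isOdd-ones : ∀ l → parity l ≡ isOdd (ones l)
parity≡isOdd-ones []          = refl
parity≡isOdd-ones (true ∷ l)  = trans (cong not (parity≡isOdd-ones l)) (sym (isOdd-suc (ones l)))
parity≡isOdd-ones (false ∷ l) = parity≡isOdd-ones l

data Swap {A : Set} : List A → List A → Set where
  here  : ∀ {x y l}   → Swap (x ∷ y ∷ l) (y ∷ x ∷ l)
  there : ∀ {x l l′} → Swap l l′ → Swap (x ∷ l) (x ∷ l′)

Swap-sym : ∀ {A : Set} {l l′ : List A} → Swap l l′ → Swap l′ l
Swap-sym here      = here
Swap-sym (there s) = there (Swap-sym s)

Swap-ones : ∀ {l l′} → Swap l l′ → ones l ≡ ones l′
Swap-ones (here {true}  {true})  = refl
Swap-ones (here {true}  {false}) = refl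
Swap-ones (here {false} {true})  = refl
Swap-ones (here {false} {false}) = refl
Swap-ones (there {true}  s)      = cong suc (Swap-ones s)
Swap-ones (there {false} s)      = Swap-ones s

sorted : List Bool → List Bool
sorted l = replicate (ones l) true ++ replicate (zeros l) false

sort : ∀ l → Star Swap l (sorted l)
sort []          = ε
sort (true ∷ l)  = gmap (true ∷_) there (sort l)
sort (false ∷ l) = gmap (false ∷_) there (sort l) ◅◅ bubble (ones l)
  where
  bubble : ∀ t → Star Swap (false ∷ replicate t true ++ replicate (zeros l) false)
                            (replicate t true ++ replicate (suc (zeros l)) false)
  bubble zero    = ε
  bubble (suc t) = here ◅ gmap (true ∷_) there (bubble t)

Swap-connected : ∀ {l l′} → length l ≡ length l′ → ones l ≡ ones l′ → Star Swap l l′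
Swap-connected {l} {l′} length-eq ones-eq =
  sort l ◅◅ subst (λ s → Star Swap s l′) (sym sorted-eq) (reverse Swap-sym (sort l′))
  where
  zeros-eq : zeros l ≡ zeros l′
  zeros-eq = +-cancelˡ-≡ (ones l) _ _
    (trans (ones+zeros≡length l) (trans length-eq
      (trans (sym (ones+zeros≡length l′)) (cong (_+ zeros l′) (sym ones-eq)))))
  sorted-eq : sorted l ≡ sorted l′
  sorted-eq = cong₂ (λ o z → replicate o true ++ replicate z false) ones-eq zeros-eq

transpose : ℕ → ℕ → ℕ
transpose zero    zero          = 1
transpose zero    (suc zero)    = 0
transpose zero    (suc (suc j)) = suc (suc j)
transpose (suc p) zero          = zero
transpose (suc p) (suc j)       = suc (transpose p j)

Swap-applyUpTo : ∀ {A : Set} k p (f : ℕ → A) → suc p < k →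
                 Swap (applyUpTo f k) (applyUpTo (λ j → f (transpose p j)) k)
Swap-applyUpTo (suc (suc k)) zero    f _         = here
Swap-applyUpTo (suc k)       (suc p) f (s<s p<k) = there (Swap-applyUpTo k p (λ j → f (suc j)) p<k)

Swap-applyUpTo⁻¹ : ∀ {A : Set} k (f : ℕ → A) {l} → Swap (applyUpTo f k) l →
                   ∃ λ p → suc p < k × l ≡ applyUpTo (λ j → f (transpose p j)) k
Swap-applyUpTo⁻¹ (suc (suc k)) f here      = 0 , s≤s (s≤s z≤n) , refl
Swap-applyUpTo⁻¹ (suc k)       f (there s) with Swap-applyUpTo⁻¹ k (λ j → f (suc j)) s
... | p , p<k , refl = suc p , s<s p<k , refl

xor-transpose : ∀ (C : ℕ → Bool) p j →
                C j xor ((C p xor C (suc p)) ∧ ((j ≡ᵇ p) xor (j ≡ᵇ suc p))) ≡ C (transpose p j)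
xor-transpose C zero    zero          = swapped (C 0) (C 1)
  where
  swapped : ∀ a b → a xor ((a xor b) ∧ true) ≡ b
  swapped = solve-∀ bool-ring
xor-transpose C zero    (suc zero)    = swapped (C 0) (C 1)
  where
  swapped : ∀ a b → b xor ((a xor b) ∧ true) ≡ a
  swapped = solve-∀ bool-ring
xor-transpose C zero    (suc (suc j)) = xor-∧-false (C (suc (suc j))) (C 0 xor C 1)
xor-transpose C (suc p) zero          = xor-∧-false (C 0) (C (suc p) xor C (suc (suc p)))
xor-transpose C (suc p) (suc j)       = xor-transpose (λ w → C (suc w)) p j

-- block x w is the indicator of the interval [x, x + w).
block : ℕ → ℕ → ℕ → Bool
block (suc x) w       zero    = false
block (suc x) w       (suc j) = block x w j
block zero    (suc w) zero    = true
block zero    (suc w) (suc j) = block zero w j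
block zero    zero    _       = false

ones-block : ∀ k x w → x + w ≤ k → ones (applyUpTo (block x w) k) ≡ w
ones-block (suc k) (suc x) w       (s≤s x+w≤k) = ones-block k x w x+w≤k
ones-block (suc k) zero    (suc w) (s≤s w≤k)   = cong suc (ones-block k zero w w≤k)
ones-block k       zero    zero    _           = ones-false k
  where
  ones-false : ∀ k → ones (applyUpTo (λ _ → false) k) ≡ 0
  ones-false zero    = refl
  ones-false (suc k) = ones-false k

block-inside : ∀ x w j → x ≤ j → j < x + w → block x w j ≡ true
block-inside (suc x) w       (suc j) (s≤s x≤j) (s<s j<) = block-inside x w j x≤j j<
block-inside zero    (suc w) zero    _         _        = refl
block-inside zero    (suc w) (suc j) _         (s<s j<) = block-inside zero w j z≤n j<

block-outside : ∀ x w j → x + w ≤ j → block x w j ≡ false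
block-outside (suc x) w       (suc j) (s≤s x+w≤j) = block-outside x w j x+w≤j
block-outside zero    (suc w) (suc j) (s≤s w≤j)   = block-outside zero w j w≤j
block-outside zero    zero    j       _           = refl

module _ {A B : Set} {R : Rel A 0ℓ} {S : Rel B 0ℓ} (f : A → B)
         (lift : ∀ {a b} → S (f a) b → ∃ λ a′ → R a a′ × f a′ ≡ b) where

  Star-lift : ∀ {a b} → Star S (f a) b → ∃ λ a′ → Star R a a′ × f a′ ≡ b
  Star-lift ε = _ , ε , refl
  Star-lift (s ◅ ss) with lift s
  ... | a′ , r , refl with Star-lift ss
  ...   | a″ , rs , eq = a″ , r ◅ rs , eq

label : ∀ {k} → Vec Bool k → ℕ → Bool
label []      _       = false
label (x ∷ a) zero    = x
label (x ∷ a) (suc w) = label a w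

label-lookup : ∀ {k} (a : Vec Bool k) i → lookup a i ≡ label a (toℕ i)
label-lookup (x ∷ a) fzero    = refl
label-lookup (x ∷ a) (fsuc i) = label-lookup a i

label-[]≔-xor : ∀ {k} (a : Vec Bool k) i z w →
                label (a [ i ]≔ (lookup a i xor z)) w ≡ label a w xor ((w ≡ᵇ toℕ i) ∧ z)
label-[]≔-xor (x ∷ a) fzero    z zero    = refl
label-[]≔-xor (x ∷ a) fzero    z (suc w) = sym (xor-identityʳ _)
label-[]≔-xor (x ∷ a) (fsuc i) z zero    = sym (xor-identityʳ _)
label-[]≔-xor (x ∷ a) (fsuc i) z (suc w) = label-[]≔-xor a i z w

label-injective : ∀ {k} (a b : Vec Bool k) → (∀ w → w < k → label a w ≡ label b w) → a ≡ b
label-injective []      []      _   = refl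
label-injective (x ∷ a) (y ∷ b) a≗b =
  cong₂ _∷_ (a≗b 0 z<s) (label-injective a b λ w w<k → a≗b (suc w) (s<s w<k))

label-tabulate : ∀ k (f : ℕ → Bool) w → w < k → label (Vec.tabulate {n = k} (λ i → f (toℕ i))) w ≡ f w
label-tabulate (suc k) f zero    _         = refl
label-tabulate (suc k) f (suc w) (s<s w<k) = label-tabulate k (λ w → f (suc w)) w w<k

foldr-xor-tabulate : ∀ {X : Set} k (f : Fin k → X) (g : X → Bool) (h : ℕ → Bool) →
                     (∀ j → g (f j) ≡ h (toℕ j)) → foldr (λ x s → g x xor s) false (tabulate f) ≡ ⊕[ k ] h
foldr-xor-tabulate zero    f g h _   = refl
foldr-xor-tabulate (suc k) f g h g≗h =
  cong₂ _xor_ (g≗h fzero) (foldr-xor-tabulate k (λ j → f (fsuc j)) g (λ w → h (suc w)) (λ j → g≗h (fsuc j)))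

label-move : ∀ {k} (G : Graph k) i a w →
             label (move G i a) w ≡ label a w xor ((w ≡ᵇ toℕ i) ∧ neighbourSum G a i)
label-move G i a = label-[]≔-xor a i (neighbourSum G a i)

label-move-elsewhere : ∀ {k} (G : Graph k) i a w → w ≢ toℕ i → label (move G i a) w ≡ label a w
label-move-elsewhere G i a w w≢i =
  trans (label-move G i a w)
        (trans (cong (λ b → label a w xor (b ∧ neighbourSum G a i)) (≢⇒≡ᵇ-false w≢i)) (xor-identityʳ _))

Loopless : ∀ {k} → Graph k → Set
Loopless G = ∀ i → adj G i i ≡ false

move-involutive : ∀ {k} (G : Graph k) → Loopless G → ∀ i a → move G i (move G i a) ≡ a
move-involutive G loopless i a = begin
  a′ [ i ]≔ (lookup a′ i xor neighbourSum G a′ i) ≡⟨ cong (λ s′ → a′ [ i ]≔ (lookup a′ i xor s′))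
                                                         neighbourSum-unchanged ⟩
  a′ [ i ]≔ (lookup a′ i xor s)                   ≡⟨ cong (λ x → a′ [ i ]≔ (x xor s)) (lookup∘update i a _) ⟩
  a′ [ i ]≔ ((lookup a i xor s) xor s)            ≡⟨ cong (a′ [ i ]≔_) (xor-cancelʳ (lookup a i) s) ⟩
  a′ [ i ]≔ lookup a i                            ≡⟨ []≔-idempotent a i ⟩
  a [ i ]≔ lookup a i                             ≡⟨ []≔-lookup a i ⟩
  a                                               ∎
  where
  open ≡-Reasoning
  s  = neighbourSum G a i
  a′ = move G i a
  xor-cancelʳ : ∀ x y → (x xor y) xor y ≡ x
  xor-cancelʳ = solve-∀ bool-ring
  -- i is not its own neighbour, and the move changes no other label.
  neighbour-unchanged : ∀ j → adj G i j ∧ lookup a′ j ≡ adj G i j ∧ lookup a j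
  neighbour-unchanged j with j Fin.≟ i
  ... | yes refl = trans (cong (_∧ lookup a′ i) (loopless i)) (cong (_∧ lookup a i) (sym (loopless i)))
  ... | no j≢i   = cong (adj G i j ∧_) (lookup∘update′ j≢i a _)
  neighbourSum-unchanged : neighbourSum G a′ i ≡ s
  neighbourSum-unchanged = foldr-cong (λ j t → cong (_xor t) (neighbour-unchanged j)) refl (allFin _)

Equiv-sym : ∀ {k} (G : Graph k) → Loopless G → ∀ {a b} → Equiv G a b → Equiv G b a
Equiv-sym G loopless = reverse step-sym
  where
  step-sym : ∀ {a b} → Step G a b → Step G b a
  step-sym {a} (i , refl) = i , sym (move-involutive G loopless i a)

-- The tree D̃ₙ for n = 5 + m

module D̃ (m : ℕ) where

  n : ℕ
  n = 5 + m

  G : Graph (suc n)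
  G = Dtilde n

  Lab : Set
  Lab = Labeling (suc n)

  data Edge : ℕ → ℕ → Set where
    edge₀      : Edge 0 2
    edge₁      : Edge 1 2
    edge-spine : ∀ {j} → 2 ≤ j → j ≤ 2 + m → Edge j (suc j)
    edgeₙ₋₁    : Edge (3 + m) (4 + m)
    edgeₙ      : Edge (3 + m) (5 + m)

  private
    ≡ᵇ-pair : ∀ {a b c d} → T ((a ≡ᵇ c) ∧ (b ≡ᵇ d)) → a ≡ c × b ≡ d
    ≡ᵇ-pair {a} {b} {c} {d} t = let a≡c , b≡d = to (T-∧ {a ≡ᵇ c}) t in ≡ᵇ⇒≡ a c a≡c , ≡ᵇ⇒≡ b d b≡d

    ≡ᵇ-refl-pair : ∀ a b → T ((a ≡ᵇ a) ∧ (b ≡ᵇ b))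
    ≡ᵇ-refl-pair a b = from (T-∧ {a ≡ᵇ a}) (≡⇒≡ᵇ a a refl , ≡⇒≡ᵇ b b refl)

    edge-at : ∀ {a b c d} → Edge c d → a ≡ c × b ≡ d → Edge a b
    edge-at e (refl , refl) = e

    spine-sound : ∀ {a b} → T ((2 ≤ᵇ a) ∧ (a ≤ᵇ 2 + m) ∧ (b ≡ᵇ suc a)) → Edge a b
    spine-sound {a} {b} t with to (T-∧ {2 ≤ᵇ a}) t
    ... | 2≤a , t′ with to (T-∧ {a ≤ᵇ 2 + m}) t′
    ...   | a≤ , b≡ with ≡ᵇ⇒≡ b (suc a) b≡
    ...     | refl = edge-spine (≤ᵇ⇒≤ 2 a 2≤a) (≤ᵇ⇒≤ a (2 + m) a≤)

    skip : ∀ x {y} → T y → T (x ∨ y)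
    skip x = from (T-∨ {x}) ∘ inj₂

    take : ∀ x {y} → T x → T (x ∨ y)
    take x = from (T-∨ {x}) ∘ inj₁

  Edge-sound : ∀ a b → T (DEdge n a b) → Edge a b
  Edge-sound a b h with to (T-∨ {(a ≡ᵇ 1) ∧ (b ≡ᵇ 2)}) h
  ... | inj₁ t = edge-at edge₁ (≡ᵇ-pair t)
  ... | inj₂ h with to (T-∨ {(a ≡ᵇ 0) ∧ (b ≡ᵇ 2)}) h
  ...   | inj₁ t = edge-at edge₀ (≡ᵇ-pair t)
  ...   | inj₂ h with to (T-∨ {(2 ≤ᵇ a) ∧ (a ≤ᵇ 2 + m) ∧ (b ≡ᵇ suc a)}) h
  ...     | inj₁ t = spine-sound t
  ...     | inj₂ h with to (T-∨ {(a ≡ᵇ 3 + m) ∧ (b ≡ᵇ 4 + m)}) h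
  ...       | inj₁ t = edge-at edgeₙ₋₁ (≡ᵇ-pair t)
  ...       | inj₂ t = edge-at edgeₙ (≡ᵇ-pair t)

  Edge-complete : ∀ {a b} → Edge a b → T (DEdge n a b)
  Edge-complete edge₀ = _
  Edge-complete edge₁ = _
  Edge-complete {j} (edge-spine 2≤j j≤) =
    skip ((j ≡ᵇ 1) ∧ (suc j ≡ᵇ 2)) (skip ((j ≡ᵇ 0) ∧ (suc j ≡ᵇ 2))
      (take ((2 ≤ᵇ j) ∧ (j ≤ᵇ 2 + m) ∧ (suc j ≡ᵇ suc j))
        (from (T-∧ {2 ≤ᵇ j}) (≤⇒≤ᵇ 2≤j , from (T-∧ {j ≤ᵇ 2 + m}) (≤⇒≤ᵇ j≤ , ≡⇒≡ᵇ j j refl)))))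
  Edge-complete edgeₙ₋₁ =
    skip ((2 ≤ᵇ 3 + m) ∧ (3 + m ≤ᵇ 2 + m) ∧ (4 + m ≡ᵇ 4 + m))
      (take ((3 + m ≡ᵇ 3 + m) ∧ (4 + m ≡ᵇ 4 + m)) (≡ᵇ-refl-pair (3 + m) (4 + m)))
  Edge-complete edgeₙ =
    skip ((2 ≤ᵇ 3 + m) ∧ (3 + m ≤ᵇ 2 + m) ∧ (5 + m ≡ᵇ 4 + m))
      (skip ((3 + m ≡ᵇ 3 + m) ∧ (5 + m ≡ᵇ 4 + m)) (≡ᵇ-refl-pair (3 + m) (5 + m)))

  Edge-< : ∀ {a b} → Edge a b → a < b
  Edge-< edge₀            = z<s
  Edge-< edge₁            = s<s z<s
  Edge-< (edge-spine _ _) = n<1+n _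
  Edge-< edgeₙ₋₁          = n<1+n _
  Edge-< edgeₙ            = m<n⇒m<1+n (n<1+n _)

  loopless : Loopless G
  loopless i = ¬T⇒≡false λ t → [ irreflexive , irreflexive ]′ (to (T-∨ {DEdge n v v}) t)
    where
    v = toℕ i
    irreflexive : ¬ T (DEdge n v v)
    irreflexive t = n≮n v (Edge-< (Edge-sound v v t))

  Adjacent : ℕ → ℕ → Set
  Adjacent v w = Edge v w ⊎ Edge w v

  adj⇔Adjacent : ∀ v w → T (DEdge n v w ∨ DEdge n w v) ⇔ Adjacent v w
  adj⇔Adjacent v w = mk⇔ (Sum.map (Edge-sound v w) (Edge-sound w v) ∘ to (T-∨ {DEdge n v w}))
                         (from (T-∨ {DEdge n v w}) ∘ Sum.map Edge-complete Edge-complete)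

  -- Vertex v p : v sits at position p, so its move swaps the coordinates p and p + 1.
  data Vertex : ℕ → ℕ → Set where
    leaf₀     : Vertex 0 0
    leaf₁     : Vertex 1 0
    branch₂   : Vertex 2 1
    spine     : ∀ {u} → u < m → Vertex (3 + u) (2 + u)
    branchₙ₋₂ : Vertex (3 + m) (2 + m)
    leafₙ₋₁   : Vertex (4 + m) (3 + m)
    leafₙ     : Vertex (5 + m) (3 + m)

  position< : ∀ {v p} → Vertex v p → suc p < n
  position< leaf₀       = s<s z<s
  position< leaf₁       = s<s z<s
  position< branch₂     = s<s (s<s z<s)
  position< (spine u<m) = s<s (s<s (s<s (m<n⇒m<1+n (m<n⇒m<1+n u<m))))
  position< branchₙ₋₂   = s<s (s<s (s<s (m<n⇒m<1+n (n<1+n m))))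
  position< leafₙ₋₁     = ≤-refl
  position< leafₙ       = ≤-refl

  inner-vertex : ∀ p → suc p < n → Vertex (suc p) p
  inner-vertex zero          _ = leaf₁
  inner-vertex (suc zero)    _ = branch₂
  inner-vertex (suc (suc u)) p<n with <-cmp u m
  ... | tri< u<m _ _  = spine u<m
  ... | tri≈ _ refl _ = branchₙ₋₂
  ... | tri> _ _ m<u with ≤-antisym (≤-pred (≤-pred (≤-pred (≤-pred p<n)))) m<u
  ...   | refl = leafₙ₋₁

  vertex : ∀ v → v ≤ n → ∃ (Vertex v)
  vertex zero    _   = 0 , leaf₀
  vertex (suc p) v≤n with m≤n⇒m<n∨m≡n v≤n
  ... | inj₁ v<n  = p , inner-vertex p v<n
  ... | inj₂ refl = 3 + m , leafₙ

  site : (i : Fin (suc n)) → ∃ (Vertex (toℕ i))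
  site i = vertex (toℕ i) (≤-pred (Fin.toℕ<n i))

  neighbours : ∀ {v p} → Vertex v p → List ℕ
  neighbours leaf₀         = 2 ∷ []
  neighbours leaf₁         = 2 ∷ []
  neighbours branch₂       = 0 ∷ 1 ∷ 3 ∷ []
  neighbours (spine {u} _) = 2 + u ∷ 4 + u ∷ []
  neighbours branchₙ₋₂     = 2 + m ∷ 4 + m ∷ 5 + m ∷ []
  neighbours leafₙ₋₁       = 3 + m ∷ []
  neighbours leafₙ         = 3 + m ∷ []

  Adjacent⇒∈ : ∀ {v p w} (x : Vertex v p) → Adjacent v w → w ∈ neighbours x
  Adjacent⇒∈ leaf₀       (inj₁ edge₀)                 = here refl
  Adjacent⇒∈ leaf₀       (inj₁ (edge-spine () _))
  Adjacent⇒∈ leaf₀       (inj₂ ())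
  Adjacent⇒∈ leaf₁       (inj₁ edge₁)                 = here refl
  Adjacent⇒∈ leaf₁       (inj₁ (edge-spine (s≤s ()) _))
  Adjacent⇒∈ leaf₁       (inj₂ (edge-spine () _))
  Adjacent⇒∈ branch₂     (inj₁ (edge-spine _ _))      = there (there (here refl))
  Adjacent⇒∈ branch₂     (inj₂ edge₀)                 = here refl
  Adjacent⇒∈ branch₂     (inj₂ edge₁)                 = there (here refl)
  Adjacent⇒∈ branch₂     (inj₂ (edge-spine (s≤s ()) _))
  Adjacent⇒∈ (spine _)   (inj₁ (edge-spine _ _))      = there (here refl)
  Adjacent⇒∈ (spine u<m) (inj₁ edgeₙ₋₁)               = ⊥-elim (n≮n m u<m)
  Adjacent⇒∈ (spine u<m) (inj₁ edgeₙ)                 = ⊥-elim (n≮n m u<m)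
  Adjacent⇒∈ (spine _)   (inj₂ (edge-spine _ _))      = here refl
  Adjacent⇒∈ (spine u<m) (inj₂ edgeₙ₋₁)               = ⊥-elim (m+n≮n 1 m u<m)
  Adjacent⇒∈ (spine u<m) (inj₂ edgeₙ)                 = ⊥-elim (m+n≮n 2 m u<m)
  Adjacent⇒∈ branchₙ₋₂   (inj₁ (edge-spine _ j≤))     = ⊥-elim (1+n≰n j≤)
  Adjacent⇒∈ branchₙ₋₂   (inj₁ edgeₙ₋₁)               = there (here refl)
  Adjacent⇒∈ branchₙ₋₂   (inj₁ edgeₙ)                 = there (there (here refl))
  Adjacent⇒∈ branchₙ₋₂   (inj₂ (edge-spine _ _))      = here refl
  Adjacent⇒∈ leafₙ₋₁     (inj₁ (edge-spine _ j≤))     = ⊥-elim (m+n≮n 1 (2 + m) j≤)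
  Adjacent⇒∈ leafₙ₋₁     (inj₂ (edge-spine _ j≤))     = ⊥-elim (1+n≰n j≤)
  Adjacent⇒∈ leafₙ₋₁     (inj₂ edgeₙ₋₁)               = here refl
  Adjacent⇒∈ leafₙ       (inj₁ (edge-spine _ j≤))     = ⊥-elim (m+n≮n 2 (2 + m) j≤)
  Adjacent⇒∈ leafₙ       (inj₂ (edge-spine _ j≤))     = ⊥-elim (m+n≮n 1 (2 + m) j≤)
  Adjacent⇒∈ leafₙ       (inj₂ edgeₙ)                 = here refl

  ∈⇒Adjacent : ∀ {v p w} (x : Vertex v p) → w ∈ neighbours x → Adjacent v w
  ∈⇒Adjacent leaf₀       (here refl)                 = inj₁ edge₀
  ∈⇒Adjacent leaf₁       (here refl)                 = inj₁ edge₁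
  ∈⇒Adjacent branch₂     (here refl)                 = inj₂ edge₀
  ∈⇒Adjacent branch₂     (there (here refl))         = inj₂ edge₁
  ∈⇒Adjacent branch₂     (there (there (here refl))) = inj₁ (edge-spine ≤-refl (m≤m+n 2 m))
  ∈⇒Adjacent (spine u<m) (here refl)                 = inj₂ (edge-spine (m≤m+n 2 _) (s≤s (s≤s (<⇒≤ u<m))))
  ∈⇒Adjacent (spine u<m) (there (here refl))         = inj₁ (edge-spine (m≤n⇒m≤1+n (m≤m+n 2 _)) (s≤s (s≤s u<m)))
  ∈⇒Adjacent branchₙ₋₂   (here refl)                 = inj₂ (edge-spine (m≤m+n 2 m) ≤-refl)
  ∈⇒Adjacent branchₙ₋₂   (there (here refl))         = inj₁ edgeₙ₋₁
  ∈⇒Adjacent branchₙ₋₂   (there (there (here refl))) = inj₁ edgeₙ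
  ∈⇒Adjacent leafₙ₋₁     (here refl)                 = inj₂ edgeₙ₋₁
  ∈⇒Adjacent leafₙ       (here refl)                 = inj₂ edgeₙ

  neighbours-unique : ∀ {v p} (x : Vertex v p) → Unique (neighbours x)
  neighbours-unique leaf₀     = [] ∷ []
  neighbours-unique leaf₁     = [] ∷ []
  neighbours-unique branch₂   = ((λ ()) ∷ (λ ()) ∷ []) ∷ ((λ ()) ∷ []) ∷ [] ∷ []
  neighbours-unique (spine _) = ((λ ()) ∷ []) ∷ [] ∷ []
  neighbours-unique branchₙ₋₂ = ((λ ()) ∷ (λ ()) ∷ []) ∷ ((λ ()) ∷ []) ∷ [] ∷ []
  neighbours-unique leafₙ₋₁   = [] ∷ []
  neighbours-unique leafₙ     = [] ∷ []

  neighbours-bounded : ∀ {v p} (x : Vertex v p) → All (_< suc n) (neighbours x)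
  neighbours-bounded x = All.tabulate (λ w∈ → s≤s (Adjacent-≤ (∈⇒Adjacent x w∈)))
    where
    Edge-≤ : ∀ {a b} → Edge a b → b ≤ n
    Edge-≤ edge₀             = s≤s (s≤s z≤n)
    Edge-≤ edge₁             = s≤s (s≤s z≤n)
    Edge-≤ (edge-spine _ j≤) = m≤n⇒m≤1+n (m≤n⇒m≤1+n (s≤s j≤))
    Edge-≤ edgeₙ₋₁           = n≤1+n _
    Edge-≤ edgeₙ             = ≤-refl
    Adjacent-≤ : ∀ {v w} → Adjacent v w → w ≤ n
    Adjacent-≤ (inj₁ e) = Edge-≤ e
    Adjacent-≤ (inj₂ e) = ≤-trans (<⇒≤ (Edge-< e)) (Edge-≤ e)

  -- Coordinates

  -- coord A j is the sum of the labels at positions j - 1 and j.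
  coord : (ℕ → Bool) → ℕ → Bool
  coord A j = A j xor (A (suc j) xor (((j ≡ᵇ 1) ∧ A 0) xor ((j ≡ᵇ 3 + m) ∧ A n)))

  private
    coord-≡ : ∀ A j {b c} → (j ≡ᵇ 1) ≡ b → (j ≡ᵇ 3 + m) ≡ c →
              coord A j ≡ A j xor (A (suc j) xor ((b ∧ A 0) xor (c ∧ A n)))
    coord-≡ A j refl refl = refl

  neighbours-parity : ∀ {v p} (x : Vertex v p) A →
                      parity (map A (neighbours x)) ≡ coord A p xor coord A (suc p)
  neighbours-parity leaf₀ A = ends (A 0) (A 1) (A 2) (A n)
    where
    ends : ∀ a₀ a₁ a₂ aₙ → a₂ xor false ≡ (a₀ xor (a₁ xor ((false ∧ a₀) xor (false ∧ aₙ))))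
                                          xor (a₁ xor (a₂ xor ((true ∧ a₀) xor (false ∧ aₙ))))
    ends = solve-∀ bool-ring
  neighbours-parity leaf₁ A = neighbours-parity leaf₀ A
  neighbours-parity branch₂ A = branch (A 0) (A 1) (A 2) (A 3) (A n)
    where
    branch : ∀ a₀ a₁ a₂ a₃ aₙ → a₀ xor (a₁ xor (a₃ xor false))
                                ≡ (a₁ xor (a₂ xor ((true ∧ a₀) xor (false ∧ aₙ))))
                                  xor (a₂ xor (a₃ xor ((false ∧ a₀) xor (false ∧ aₙ))))
    branch = solve-∀ bool-ring
  neighbours-parity (spine {u} u<m) A =
    trans (path (A (2 + u)) (A (3 + u)) (A (4 + u)) (A 0) (A n))
          (sym (cong₂ _xor_ (coord-≡ A (2 + u) refl (≢⇒≡ᵇ-false (u≢ 1 ∘ suc-injective ∘ suc-injective)))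
                            (coord-≡ A (3 + u) refl (≢⇒≡ᵇ-false (u≢ 0 ∘ suc-injective ∘ suc-injective
                                                                      ∘ suc-injective)))))
    where
    u≢ : ∀ k → u ≢ k + m
    u≢ k u≡ = m+n≮n k m (subst (_< m) u≡ u<m)
    path : ∀ a b c a₀ aₙ → a xor (c xor false) ≡ (a xor (b xor ((false ∧ a₀) xor (false ∧ aₙ))))
                                               xor (b xor (c xor ((false ∧ a₀) xor (false ∧ aₙ))))
    path = solve-∀ bool-ring
  neighbours-parity branchₙ₋₂ A =
    trans (branch (A (2 + m)) (A (3 + m)) (A (4 + m)) (A n) (A 0))
          (sym (cong₂ _xor_ (coord-≡ A (2 + m) refl (≢⇒≡ᵇ-false {2 + m} {3 + m} λ ()))
                            (coord-≡ A (3 + m) refl (≡ᵇ-refl (3 + m)))))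
    where
    branch : ∀ a b c d a₀ → a xor (c xor (d xor false)) ≡ (a xor (b xor ((false ∧ a₀) xor (false ∧ d))))
                                                         xor (b xor (c xor ((false ∧ a₀) xor (true ∧ d))))
    branch = solve-∀ bool-ring
  neighbours-parity leafₙ₋₁ A =
    trans (ends (A (3 + m)) (A (4 + m)) (A n) (A 0))
          (sym (cong₂ _xor_ (coord-≡ A (3 + m) refl (≡ᵇ-refl (3 + m)))
                            (coord-≡ A (4 + m) refl (≢⇒≡ᵇ-false {4 + m} {3 + m} λ ()))))
    where
    ends : ∀ b c d a₀ → b xor false ≡ (b xor (c xor ((false ∧ a₀) xor (true ∧ d))))
                                      xor (c xor (d xor ((false ∧ a₀) xor (false ∧ d))))
    ends = solve-∀ bool-ring
  neighbours-parity leafₙ A = neighbours-parity leafₙ₋₁ A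

  private
    unit-coord₀ : ∀ j → coord (λ w → w ≡ᵇ 0) j ≡ (j ≡ᵇ 0) xor (j ≡ᵇ 1)
    unit-coord₀ j = at₀ (j ≡ᵇ 0) (j ≡ᵇ 1) (j ≡ᵇ 3 + m)
      where
      at₀ : ∀ x y z → x xor (false xor ((y ∧ true) xor (z ∧ false))) ≡ x xor y
      at₀ = solve-∀ bool-ring

    unit-coord-inner : ∀ p → suc p < n → ∀ j → coord (λ w → w ≡ᵇ suc p) j ≡ (j ≡ᵇ p) xor (j ≡ᵇ suc p)
    unit-coord-inner p p<n j =
      trans (cong (λ c → (j ≡ᵇ suc p) xor ((j ≡ᵇ p) xor (((j ≡ᵇ 1) ∧ false) xor ((j ≡ᵇ 3 + m) ∧ c))))
                  (≢⇒≡ᵇ-false {n} {suc p} λ n≡ → <-irrefl (sym n≡) p<n))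
            (inner (j ≡ᵇ suc p) (j ≡ᵇ p) (j ≡ᵇ 1) (j ≡ᵇ 3 + m))
      where
      inner : ∀ x y z w → x xor (y xor ((z ∧ false) xor (w ∧ false))) ≡ y xor x
      inner = solve-∀ bool-ring

    unit-coordₙ : ∀ j → j < n → coord (λ w → w ≡ᵇ n) j ≡ (j ≡ᵇ 3 + m) xor (j ≡ᵇ 4 + m)
    unit-coordₙ j j<n =
      trans (cong₂ (λ b c → b xor ((j ≡ᵇ 4 + m) xor (((j ≡ᵇ 1) ∧ false) xor ((j ≡ᵇ 3 + m) ∧ c))))
                   (≢⇒≡ᵇ-false (<⇒≢ j<n)) (≡ᵇ-refl n))
            (atₙ (j ≡ᵇ 4 + m) (j ≡ᵇ 1) (j ≡ᵇ 3 + m))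
      where
      atₙ : ∀ x y z → false xor (x xor ((y ∧ false) xor (z ∧ true))) ≡ z xor x
      atₙ = solve-∀ bool-ring

  unit-coord : ∀ {v p} → Vertex v p → ∀ j → j < n → coord (λ w → w ≡ᵇ v) j ≡ (j ≡ᵇ p) xor (j ≡ᵇ suc p)
  unit-coord leaf₀       j _   = unit-coord₀ j
  unit-coord x@leaf₁     j _   = unit-coord-inner _ (position< x) j
  unit-coord x@branch₂   j _   = unit-coord-inner _ (position< x) j
  unit-coord x@(spine _) j _   = unit-coord-inner _ (position< x) j
  unit-coord x@branchₙ₋₂ j _   = unit-coord-inner _ (position< x) j
  unit-coord x@leafₙ₋₁   j _   = unit-coord-inner _ (position< x) j
  unit-coord leafₙ       j j<n = unit-coordₙ j j<n

  coord-cong : ∀ {A B} → (∀ w → A w ≡ B w) → ∀ j → coord A j ≡ coord B j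
  coord-cong A≗B j = cong₂ _xor_ (A≗B j) (cong₂ _xor_ (A≗B (suc j))
                       (cong₂ _xor_ (cong ((j ≡ᵇ 1) ∧_) (A≗B 0)) (cong ((j ≡ᵇ 3 + m) ∧_) (A≗B n))))

  coord-linear : ∀ A D s j → coord (λ w → A w xor (D w ∧ s)) j ≡ coord A j xor (s ∧ coord D j)
  coord-linear A D s j =
    linear (A j) (A (suc j)) (A 0) (A n) (D j) (D (suc j)) (D 0) (D n) (j ≡ᵇ 1) (j ≡ᵇ 3 + m) s
    where
    linear : ∀ a₁ a₂ a₃ a₄ d₁ d₂ d₃ d₄ c₁ c₂ s →
             (a₁ xor (d₁ ∧ s)) xor ((a₂ xor (d₂ ∧ s))
                               xor ((c₁ ∧ (a₃ xor (d₃ ∧ s))) xor (c₂ ∧ (a₄ xor (d₄ ∧ s)))))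
             ≡ (a₁ xor (a₂ xor ((c₁ ∧ a₃) xor (c₂ ∧ a₄))))
               xor (s ∧ (d₁ xor (d₂ xor ((c₁ ∧ d₃) xor (c₂ ∧ d₄)))))
    linear = solve-∀ bool-ring

  neighbourSum≡coords : ∀ {i p} → Vertex (toℕ i) p → ∀ a →
                        neighbourSum G a i ≡ coord (label a) p xor coord (label a) (suc p)
  neighbourSum≡coords {i} {p} x a = begin
    neighbourSum G a i                             ≡⟨ foldr-xor-tabulate (suc n) id (λ j → adj G i j ∧ lookup a j)
                                                        (λ w → E w ∧ label a w)
                                                        (λ j → cong (adj G i j ∧_) (label-lookup a j)) ⟩
    ⊕[ suc n ] (λ w → E w ∧ label a w)             ≡⟨ ⊕-support (suc n) E (label a) (neighbours x)
                                                        (neighbours-unique x) (neighbours-bounded x) E⇔ ⟩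
    parity (map (label a) (neighbours x))          ≡⟨ neighbours-parity x (label a) ⟩
    coord (label a) p xor coord (label a) (suc p)  ∎
    where
    open ≡-Reasoning
    v = toℕ i
    E : ℕ → Bool
    E w = DEdge n v w ∨ DEdge n w v
    E⇔ : ∀ w → T (E w) ⇔ w ∈ neighbours x
    E⇔ w = mk⇔ (Adjacent⇒∈ x ∘ to (adj⇔Adjacent v w)) (from (adj⇔Adjacent v w) ∘ ∈⇒Adjacent x)

  coord-move : ∀ {i p} → Vertex (toℕ i) p → ∀ a j → j < n →
               coord (label (move G i a)) j ≡ coord (label a) (transpose p j)
  coord-move {i} {p} x a j j<n = begin
    coord (label (move G i a)) j                    ≡⟨ coord-cong (label-move G i a) j ⟩
    coord (λ w → A w xor ((w ≡ᵇ v) ∧ s)) j          ≡⟨ coord-linear A (λ w → w ≡ᵇ v) s j ⟩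
    coord A j xor (s ∧ coord (λ w → w ≡ᵇ v) j)      ≡⟨ cong (λ c → coord A j xor (s ∧ c)) (unit-coord x j j<n) ⟩
    coord A j xor (s ∧ swapped)                     ≡⟨ cong (λ s′ → coord A j xor (s′ ∧ swapped))
                                                            (neighbourSum≡coords x a) ⟩
    coord A j xor ((coord A p xor coord A (suc p)) ∧ swapped) ≡⟨ xor-transpose (coord A) p j ⟩
    coord A (transpose p j)                         ∎
    where
    open ≡-Reasoning
    A = label a
    v = toℕ i
    s = neighbourSum G a i
    swapped = (j ≡ᵇ p) xor (j ≡ᵇ suc p)

  coordList : Lab → List Bool
  coordList a = applyUpTo (coord (label a)) n

  weight : Lab → ℕ
  weight a = ones (coordList a)

  corners : Lab → Bool × Bool
  corners a = label a 0 , label a n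

  coordList-move : ∀ {i p} → Vertex (toℕ i) p → ∀ a →
                   coordList (move G i a) ≡ applyUpTo (λ j → coord (label a) (transpose p j)) n
  coordList-move x a = applyUpTo-cong n (coord-move x a)

  move-weight : ∀ i a → weight (move G i a) ≡ weight a
  move-weight i a with site i
  ... | p , x = trans (cong ones (coordList-move x a))
                      (sym (Swap-ones (Swap-applyUpTo n p (coord (label a)) (position< x))))

  move-id-at-weight-0 : ∀ i a → weight a ≡ 0 → move G i a ≡ a
  move-id-at-weight-0 i a weight≡0 with site i
  ... | p , x = begin
    a [ i ]≔ (lookup a i xor neighbourSum G a i) ≡⟨ cong (λ s → a [ i ]≔ (lookup a i xor s)) neighbourSum≡false ⟩
    a [ i ]≔ (lookup a i xor false)              ≡⟨ cong (a [ i ]≔_) (xor-identityʳ _) ⟩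
    a [ i ]≔ lookup a i                          ≡⟨ []≔-lookup a i ⟩
    a                                            ∎
    where
    open ≡-Reasoning
    coord≡false : ∀ j → j < n → coord (label a) j ≡ false
    coord≡false = ones≡0⇒false n (coord (label a)) weight≡0
    neighbourSum≡false : neighbourSum G a i ≡ false
    neighbourSum≡false = trans (neighbourSum≡coords x a)
      (cong₂ _xor_ (coord≡false p (<-trans (n<1+n p) (position< x))) (coord≡false (suc p) (position< x)))

  ⊕-coord : ∀ A → ⊕[ n ] (coord A) ≡ false
  ⊕-coord A = begin
    ⊕[ n ] (coord A)                                ≡⟨ ⊕-cong n (λ j _ → regroup (A j) (A (suc j)) (δ₁ j) (δₙ₋₂ j)) ⟩
    ⊕[ n ] (λ j → Δ j xor (δ₁ j xor δₙ₋₂ j))        ≡⟨ ⊕-xor n Δ (λ j → δ₁ j xor δₙ₋₂ j) ⟩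
    ⊕[ n ] Δ xor ⊕[ n ] (λ j → δ₁ j xor δₙ₋₂ j)     ≡⟨ cong₂ _xor_ (⊕-telescope n A) (⊕-xor n δ₁ δₙ₋₂) ⟩
    (A 0 xor A n) xor (⊕[ n ] δ₁ xor ⊕[ n ] δₙ₋₂)   ≡⟨ cong ((A 0 xor A n) xor_) (cong₂ _xor_
                                                         (⊕-indicator n 1 (λ _ → A 0) (s<s z<s))
                                                         (⊕-indicator n (3 + m) (λ _ → A n) (n≤1+n _))) ⟩
    (A 0 xor A n) xor (A 0 xor A n)                 ≡⟨ xor-same (A 0 xor A n) ⟩
    false                                           ∎
    where
    open ≡-Reasoning
    Δ : ℕ → Bool
    Δ j = A j xor A (suc j)
    δ₁ δₙ₋₂ : ℕ → Bool
    δ₁ j   = (j ≡ᵇ 1) ∧ A 0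
    δₙ₋₂ j = (j ≡ᵇ 3 + m) ∧ A n
    regroup : ∀ a b c d → a xor (b xor (c xor d)) ≡ (a xor b) xor (c xor d)
    regroup = solve-∀ bool-ring

  weight-even : ∀ a → isOdd (weight a) ≡ false
  weight-even a = trans (sym (parity≡isOdd-ones (coordList a))) (⊕-coord (label a))

  weight≤n : ∀ a → weight a ≤ n
  weight≤n a = subst (weight a ≤_) (length-applyUpTo (coord (label a)) n) (ones≤length (coordList a))

  private
    corrections : Bool → Bool → ℕ → Bool
    corrections x y j = ((j ≡ᵇ 1) ∧ x) xor ((j ≡ᵇ 3 + m) ∧ y)

    next-label : ∀ A j → A (suc j) ≡ coord A j xor (A j xor corrections (A 0) (A n) j)
    next-label A j = solve (A j) (A (suc j)) (corrections (A 0) (A n) j)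
      where
      solve : ∀ x y u → y ≡ (x xor (y xor u)) xor (x xor u)
      solve = solve-∀ bool-ring

  coordinates-injective : ∀ a b → coordList a ≡ coordList b → corners a ≡ corners b → a ≡ b
  coordinates-injective a b coords-eq corners-eq = label-injective a b λ w w<1+n →
    [ below w , (λ { refl → cong proj₂ corners-eq }) ]′ (m≤n⇒m<n∨m≡n (≤-pred w<1+n))
    where
    coord-eq = applyUpTo-injective n {coord (label a)} {coord (label b)} coords-eq
    below : ∀ w → w < n → label a w ≡ label b w
    below zero    _     = cong proj₁ corners-eq
    below (suc j) 1+j<n =
      trans (next-label (label a) j)
            (trans (cong₂ _xor_ (coord-eq j j<n)
                                (cong₂ _xor_ (below j j<n)
                                             (cong₂ (λ x y → corrections x y j) (cong proj₁ corners-eq)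
                                                                                (cong proj₂ corners-eq))))
                   (sym (next-label (label b) j)))
      where j<n = <-trans (n<1+n j) 1+j<n

  realise : ∀ (t : ℕ → Bool) → ⊕[ n ] t ≡ false → ∀ x y →
            ∃ λ a → coordList a ≡ applyUpTo t n × corners a ≡ (x , y)
  realise t ⊕t≡false x y = a , applyUpTo-cong n coord≡t , cong₂ _,_ (label-a 0 z<s) label-aₙ
    where
    labels : ℕ → Bool
    labels zero    = x
    labels (suc j) = t j xor (labels j xor corrections x y j)

    labels-with-corner : ℕ → Bool
    labels-with-corner w = if w ≡ᵇ n then y else labels w

    a : Lab
    a = Vec.tabulate λ i → labels-with-corner (toℕ i)

    label-a : ∀ w → w < n → label a w ≡ labels w
    label-a w w<n = trans (label-tabulate (suc n) labels-with-corner w (m<n⇒m<1+n w<n))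
                          (cong (λ b → if b then y else labels w) (≢⇒≡ᵇ-false (<⇒≢ w<n)))

    label-aₙ : label a n ≡ y
    label-aₙ = trans (label-tabulate (suc n) labels-with-corner n ≤-refl)
                     (cong (λ b → if b then y else labels n) (≡ᵇ-refl n))

    coord≡t-below : ∀ j → suc j < n → coord (label a) j ≡ t j
    coord≡t-below j 1+j<n =
      trans (cong₂ (λ c d → c xor (d xor corrections (label a 0) (label a n) j))
                   (label-a j (<-trans (n<1+n j) 1+j<n)) (label-a (suc j) 1+j<n))
            (trans (cong (λ c → labels j xor (labels (suc j) xor c))
                         (cong₂ (λ x y → corrections x y j) (label-a 0 z<s) label-aₙ))
                   (recovered (t j) (labels j) (corrections x y j)))
      where
      recovered : ∀ c l u → l xor ((c xor (l xor u)) xor u) ≡ c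
      recovered = solve-∀ bool-ring

    -- The last coordinate is forced by the parity of all coordinates.
    coord≡t-last : coord (label a) (4 + m) ≡ t (4 + m)
    coord≡t-last = xor-cancelˡ (⊕[ 4 + m ] t) (begin
      ⊕[ 4 + m ] t xor C (4 + m)         ≡⟨ cong (_xor C (4 + m)) (⊕-cong (4 + m) λ j j<4+m →
                                                                      sym (coord≡t-below j (s<s j<4+m))) ⟩
      ⊕[ 4 + m ] C xor C (4 + m)         ≡⟨ sym (⊕-snoc (4 + m) C) ⟩
      ⊕[ n ] C                           ≡⟨ ⊕-coord (label a) ⟩
      false                              ≡⟨ sym ⊕t≡false ⟩
      ⊕[ n ] t                           ≡⟨ ⊕-snoc (4 + m) t ⟩
      ⊕[ 4 + m ] t xor t (4 + m)         ∎)
      where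
      open ≡-Reasoning
      C = coord (label a)

    coord≡t : ∀ j → j < n → coord (label a) j ≡ t j
    coord≡t j j<n with m≤n⇒m<n∨m≡n (≤-pred j<n)
    ... | inj₁ j<4+m = coord≡t-below j (s<s j<4+m)
    ... | inj₂ refl  = coord≡t-last

  -- Connectivity

  coordinates : Lab → List Bool × (Bool × Bool)
  coordinates a = coordList a , corners a

  private
    inner-site : ∀ p → suc p < n → ∃ λ i → Vertex (toℕ i) p × toℕ i ≡ suc p
    inner-site p p<n = i , subst (λ v → Vertex v p) (sym toℕ-i) (inner-vertex p p<n) , toℕ-i
      where
      i : Fin (suc n)
      i = fromℕ< (m<n⇒m<1+n p<n)
      toℕ-i : toℕ i ≡ suc p
      toℕ-i = Fin.toℕ-fromℕ< (m<n⇒m<1+n p<n)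

    swap-by-move : ∀ {a b} → Pointwise Swap _≡_ (coordinates a) b →
                   ∃ λ a′ → Step G a a′ × coordinates a′ ≡ b
    swap-by-move {a} (s , corners≡) with Swap-applyUpTo⁻¹ n (coord (label a)) s
    ... | p , p<n , refl with inner-site p p<n
    ...   | i , x , toℕ-i =
      move G i a , (i , refl) ,
      cong₂ _,_ (coordList-move x a)
                (trans (cong₂ _,_ (label-move-elsewhere G i a 0 λ 0≡i → 0≢1+n (trans 0≡i toℕ-i))
                                  (label-move-elsewhere G i a n λ n≡i → <-irrefl (sym (trans n≡i toℕ-i)) p<n))
                       corners≡)

  permute-coordinates : ∀ a {l} → Star Swap (coordList a) l →
                        ∃ λ b → Equiv G a b × coordList b ≡ l × corners b ≡ corners a
  permute-coordinates a ss
    with Star-lift {S = Pointwise Swap _≡_} coordinates swap-by-move (gmap (_, corners a) (_, refl) ss)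
  ... | b , a⇝b , eq = b , a⇝b , cong proj₁ eq , cong proj₂ eq

  equal-weight-and-corners⇒Equiv : ∀ a b → weight a ≡ weight b → corners a ≡ corners b → Equiv G a b
  equal-weight-and-corners⇒Equiv a b weight≡ corners≡
    with permute-coordinates a (Swap-connected (trans (length-applyUpTo (coord (label a)) n)
                                                     (sym (length-applyUpTo (coord (label b)) n))) weight≡)
  ... | c , a⇝c , coords≡ , corners-c =
    subst (Equiv G a) (coordinates-injective c b coords≡ (trans corners-c corners≡)) a⇝c

  arrange-coordinates : ∀ a (t : ℕ → Bool) → ones (applyUpTo t n) ≡ weight a →
                        ∃ λ c → Equiv G a c × (∀ j → j < n → coord (label c) j ≡ t j)
                                × weight c ≡ weight a × corners c ≡ corners a
  arrange-coordinates a t ones≡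
    with permute-coordinates a (Swap-connected (trans (length-applyUpTo (coord (label a)) n)
                                                     (sym (length-applyUpTo t n))) (sym ones≡))
  ... | c , a⇝c , coords≡ , corners≡ =
    c , a⇝c , applyUpTo-injective n {coord (label c)} coords≡ , trans (cong ones coords≡) ones≡ , corners≡

  set-label : ∀ {i p} → Vertex (toℕ i) p → ∀ a → coord (label a) p xor coord (label a) (suc p) ≡ true → ∀ z →
              ∃ λ b → Equiv G a b × weight b ≡ weight a × label b (toℕ i) ≡ z
                      × (∀ w → w ≢ toℕ i → label b w ≡ label a w)
  set-label {i} x a differ z with label a (toℕ i) ≟ᴮ z
  ... | yes refl = a , ε , refl , refl , λ _ _ → refl
  ... | no ≢z    = move G i a , (i , refl) ◅ ε , move-weight i a , flipped , label-move-elsewhere G i a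
    where
    open ≡-Reasoning
    v = toℕ i
    flipped : label (move G i a) v ≡ z
    flipped = begin
      label (move G i a) v                          ≡⟨ label-move G i a v ⟩
      label a v xor ((v ≡ᵇ v) ∧ neighbourSum G a i) ≡⟨ cong₂ (λ b c → label a v xor (b ∧ c)) (≡ᵇ-refl v)
                                                               (trans (neighbourSum≡coords x a) differ) ⟩
      label a v xor true                            ≡⟨ cong (label a v xor_) (sym (≢⇒xor-true ≢z)) ⟩
      label a v xor (label a v xor z)               ≡⟨ cancel (label a v) z ⟩
      z                                             ∎
      where
      cancel : ∀ a b → a xor (a xor b) ≡ b
      cancel = solve-∀ bool-ring

  set-corner₀ : ∀ a → 0 < weight a → weight a < n → ∀ z →
                ∃ λ b → Equiv G a b × weight b ≡ weight a × corners b ≡ (z , label a n)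
  set-corner₀ a 0<w w<n z =
    let c , a⇝c , c≗t , weight-c , corners-c = arrange-coordinates a (block 1 w) (ones-block n 1 w w<n)
        differ = cong₂ _xor_ (c≗t 0 z<s) (trans (c≗t 1 (s<s z<s)) (block-inside 1 w 1 ≤-refl (s<s 0<w)))
        b , c⇝b , weight-b , b₀≡z , elsewhere = set-label {i = fzero} leaf₀ c differ z
    in b , a⇝c ◅◅ c⇝b , trans weight-b weight-c ,
       cong₂ _,_ b₀≡z (trans (elsewhere n λ ()) (cong proj₂ corners-c))
    where
    w = weight a

  set-cornerₙ : ∀ a → 0 < weight a → weight a < n → ∀ z →
                ∃ λ b → Equiv G a b × weight b ≡ weight a × corners b ≡ (label a 0 , z)
  set-cornerₙ a 0<w w<n z =
    let c , a⇝c , c≗t , weight-c , corners-c =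
          arrange-coordinates a (block x w) (ones-block n x w (subst (_≤ n) (sym x+w≡) (n≤1+n _)))
        differ = cong₂ _xor_
          (trans (c≗t (3 + m) (<-trans (n<1+n _) (n<1+n _)))
                 (block-inside x w (3 + m) (∸-monoʳ-≤ (4 + m) 0<w) (subst (3 + m <_) (sym x+w≡) ≤-refl)))
          (trans (c≗t (4 + m) (n<1+n _)) (block-outside x w (4 + m) (≤-reflexive x+w≡)))
        b , c⇝b , weight-b , bₙ≡z , elsewhere = set-label {i = iₙ} vertex-iₙ c differ z
    in b , a⇝c ◅◅ c⇝b , trans weight-b weight-c ,
       cong₂ _,_ (trans (elsewhere 0 λ 0≡iₙ → 0≢1+n (trans 0≡iₙ toℕ-iₙ)) (cong proj₁ corners-c))
                 (subst (λ v → label b v ≡ z) toℕ-iₙ bₙ≡z)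
    where
    w = weight a
    x = 4 + m ∸ w
    x+w≡ : x + w ≡ 4 + m
    x+w≡ = m∸n+n≡m (≤-pred w<n)
    iₙ : Fin (suc n)
    iₙ = fromℕ n
    toℕ-iₙ : toℕ iₙ ≡ n
    toℕ-iₙ = Fin.toℕ-fromℕ n
    vertex-iₙ : Vertex (toℕ iₙ) (3 + m)
    vertex-iₙ = subst (λ v → Vertex v (3 + m)) (sym toℕ-iₙ) leafₙ

  adjust-corners : ∀ a → 0 < weight a → weight a < n → ∀ x y →
                   ∃ λ b → Equiv G a b × weight b ≡ weight a × corners b ≡ (x , y)
  adjust-corners a 0<w w<n x y =
    let b , a⇝b , weight-b , corners-b = set-corner₀ a 0<w w<n x
        c , b⇝c , weight-c , corners-c =
          set-cornerₙ b (subst (0 <_) (sym weight-b) 0<w) (subst (_< n) (sym weight-b) w<n) y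
    in c , a⇝b ◅◅ b⇝c , trans weight-c weight-b , trans corners-c (cong (_, y) (cong proj₁ corners-b))

-- Counting the classes for n = 5 + 2K

module Classification (K : ℕ) where

  open D̃ (K + K)

  weight<n : ∀ a → weight a < n
  weight<n a = ≤∧≢⇒< (weight≤n a) λ weight≡n →
    true≢false (trans (sym n-odd) (trans (cong isOdd (sym weight≡n)) (weight-even a)))
    where
    n-odd : isOdd n ≡ true
    n-odd = trans (isOdd-suc (K + K)) (cong not (isOdd-double K))
    true≢false : true ≢ false
    true≢false ()

  Class : Set
  Class = Fin (6 + K)

  corner-class : Bool → Bool → Class
  corner-class false false = fzero
  corner-class true  false = fsuc fzero
  corner-class false true  = fsuc (fsuc fzero)
  corner-class true  true  = fsuc (fsuc (fsuc fzero))

  corner-class-injective : ∀ {x y x′ y′} → corner-class x y ≡ corner-class x′ y′ → (x , y) ≡ (x′ , y′)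
  corner-class-injective {x} {y} {x′} {y′} eq =
    trans (sym (inverse x y)) (trans (cong corners-of eq) (inverse x′ y′))
    where
    corners-of : Class → Bool × Bool
    corners-of fzero               = false , false
    corners-of (fsuc fzero)        = true , false
    corners-of (fsuc (fsuc fzero)) = false , true
    corners-of _                   = true , true
    inverse : ∀ x y → corners-of (corner-class x y) ≡ (x , y)
    inverse false false = refl
    inverse true  false = refl
    inverse false true  = refl
    inverse true  true  = refl

  corner-class≢ : ∀ x y c → corner-class x y ≢ fsuc (fsuc (fsuc (fsuc c)))
  corner-class≢ false false _ ()
  corner-class≢ true  false _ ()
  corner-class≢ false true  _ ()
  corner-class≢ true  true  _ ()

  half< : ∀ {w} → 2 + w < n → ⌊ w /2⌋ < 2 + K
  half< (s≤s (s≤s (s≤s w≤))) =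
    s≤s (≤-trans (⌊n/2⌋-mono w≤) (≤-reflexive (cong suc (sym (n≡⌊n+n/2⌋ K)))))

  -- Odd weights do not occur; the weight 2 + w gives the class 4 + ⌊ w / 2 ⌋.
  weight-class : ∀ w → .(w < n) → Bool → Bool → Class
  weight-class zero          _   x y = corner-class x y
  weight-class (suc zero)    _   _ _ = fzero
  weight-class (suc (suc w)) w<n _ _ = fsuc (fsuc (fsuc (fsuc (fromℕ< (half< w<n)))))

  classOf : Lab → Class
  classOf a = weight-class (weight a) (weight<n a) (label a 0) (label a n)

  weight-class-cong : ∀ {w w′} → w ≡ w′ → .(p : w < n) .(p′ : w′ < n) → ∀ x y →
                      weight-class w p x y ≡ weight-class w′ p′ x y
  weight-class-cong refl _ _ _ _ = refl

  weight-class-corners : ∀ w .(p : w < n) x y x′ y′ → w ≢ 0 → weight-class w p x y ≡ weight-class w p x′ y′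
  weight-class-corners zero          _ _ _ _ _ w≢0 = ⊥-elim (w≢0 refl)
  weight-class-corners (suc zero)    _ _ _ _ _ _   = refl
  weight-class-corners (suc (suc w)) _ _ _ _ _ _   = refl

  weight-class-injective : ∀ w w′ .(p : w < n) .(p′ : w′ < n) x y x′ y′ →
                           isOdd w ≡ false → isOdd w′ ≡ false → weight-class w p x y ≡ weight-class w′ p′ x′ y′ →
                           w ≡ w′ × (w ≡ 0 → (x , y) ≡ (x′ , y′))
  weight-class-injective zero          zero           _ _ _ _ _ _ _    _     eq = refl , λ _ → corner-class-injective eq
  weight-class-injective zero          (suc (suc w′)) _ _ x y _ _ _    _     eq = ⊥-elim (corner-class≢ x y _ eq)
  weight-class-injective (suc (suc w)) zero           _ _ _ _ x y _    _     eq = ⊥-elim (corner-class≢ x y _ (sym eq))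
  weight-class-injective (suc (suc w)) (suc (suc w′)) p p′ _ _ _ _ even even′ eq = cong (2 +_) w≡w′ , λ ()
    where
    fsuc-injective⁴ : ∀ {c c′ : Fin (2 + K)} →
                      _≡_ {A = Class} (fsuc (fsuc (fsuc (fsuc c)))) (fsuc (fsuc (fsuc (fsuc c′)))) → c ≡ c′
    fsuc-injective⁴ = Fin.suc-injective ∘ Fin.suc-injective ∘ Fin.suc-injective ∘ Fin.suc-injective
    half≡ : ⌊ w /2⌋ ≡ ⌊ w′ /2⌋
    half≡ = trans (sym (Fin.toℕ-fromℕ< (half< p)))
                  (trans (cong toℕ (fsuc-injective⁴ eq)) (Fin.toℕ-fromℕ< (half< p′)))
    w≡w′ : w ≡ w′
    w≡w′ = trans (sym (even⇒⌊n/2⌋+⌊n/2⌋≡n w even))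
                 (trans (cong (λ h → h + h) half≡) (even⇒⌊n/2⌋+⌊n/2⌋≡n w′ even′))

  classOf-move : ∀ i a → classOf (move G i a) ≡ classOf a
  classOf-move i a = by-weight (weight a ≟ 0)
    where
    a′ = move G i a
    by-weight : Dec (weight a ≡ 0) → classOf a′ ≡ classOf a
    by-weight (yes weight≡0) = cong classOf (move-id-at-weight-0 i a weight≡0)
    by-weight (no  weight≢0) =
      trans (weight-class-cong (move-weight i a) (weight<n a′) (weight<n a) (label a′ 0) (label a′ n))
            (weight-class-corners (weight a) (weight<n a) (label a′ 0) (label a′ n) (label a 0) (label a n) weight≢0)

  Equiv⇒same-class : ∀ {a b} → Equiv G a b → classOf a ≡ classOf b
  Equiv⇒same-class ε                            = refl
  Equiv⇒same-class {a} ((i , refl) ◅ a′⇝b) = trans (sym (classOf-move i a)) (Equiv⇒same-class a′⇝b)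

  same-class⇒Equiv : ∀ a b → classOf a ≡ classOf b → Equiv G a b
  same-class⇒Equiv a b eq = by-weight (weight a ≟ 0)
    where
    weights-and-corners : weight a ≡ weight b × (weight a ≡ 0 → corners a ≡ corners b)
    weights-and-corners = weight-class-injective (weight a) (weight b) (weight<n a) (weight<n b)
                            (label a 0) (label a n) (label b 0) (label b n) (weight-even a) (weight-even b) eq
    weight≡ : weight a ≡ weight b
    weight≡ = proj₁ weights-and-corners
    by-weight : Dec (weight a ≡ 0) → Equiv G a b
    by-weight (yes weight≡0) = equal-weight-and-corners⇒Equiv a b weight≡ (proj₂ weights-and-corners weight≡0)
    by-weight (no  weight≢0) =
      let b′ , b⇝b′ , weight-b′ , corners-b′ =
            adjust-corners b (n≢0⇒n>0 (weight≢0 ∘ trans weight≡)) (weight<n b) (label a 0) (label a n)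
      in equal-weight-and-corners⇒Equiv a b′ (trans weight≡ (sym weight-b′)) (sym corners-b′)
         ◅◅ Equiv-sym G loopless b⇝b′

  labeling-of-weight : ∀ w → w ≤ n → isOdd w ≡ false → ∀ x y →
                       ∃ λ a → weight a ≡ w × corners a ≡ (x , y)
  labeling-of-weight w w≤n even x y =
    let a , coords≡ , corners≡ = realise t ⊕t≡false x y
    in a , trans (cong ones coords≡) ones≡ , corners≡
    where
    t = block 0 w
    ones≡ : ones (applyUpTo t n) ≡ w
    ones≡ = ones-block n 0 w w≤n
    ⊕t≡false : ⊕[ n ] t ≡ false
    ⊕t≡false = trans (parity≡isOdd-ones (applyUpTo t n)) (trans (cong isOdd ones≡) even)

  weightless : ∀ x y → ∃ λ a → classOf a ≡ corner-class x y
  weightless x y =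
    let a , weight≡0 , corners≡ = labeling-of-weight 0 z≤n refl x y
    in a , trans (weight-class-cong weight≡0 (weight<n a) z<s (label a 0) (label a n))
                 (cong (uncurry corner-class) corners≡)

  classOf-surjective : ∀ c → ∃ λ a → classOf a ≡ c
  classOf-surjective fzero                         = weightless false false
  classOf-surjective (fsuc fzero)                  = weightless true false
  classOf-surjective (fsuc (fsuc fzero))           = weightless false true
  classOf-surjective (fsuc (fsuc (fsuc fzero)))    = weightless true true
  classOf-surjective (fsuc (fsuc (fsuc (fsuc c)))) =
    let a , weight≡ , _ = labeling-of-weight (2 + (t + t)) (<⇒≤ W<n) (isOdd-double t) false false
    in a , trans (weight-class-cong weight≡ (weight<n a) W<n (label a 0) (label a n))
                 (cong (λ c′ → fsuc (fsuc (fsuc (fsuc c′)))) (fromℕ<-≡ (sym (n≡⌊n+n/2⌋ t))))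
    where
    t = toℕ c
    W<n : 2 + (t + t) < n
    W<n = s≤s (s≤s (s≤s (≤-trans (+-mono-≤ t≤ t≤) (≤-reflexive (cong suc (+-suc K K))))))
      where
      t≤ : t ≤ suc K
      t≤ = ≤-pred (Fin.toℕ<n c)
    fromℕ<-≡ : ∀ {j} .{j<k : j < 2 + K} → j ≡ t → fromℕ< j<k ≡ c
    fromℕ<-≡ {j<k = j<k} refl = Fin.fromℕ<-toℕ c j<k

  classification : HasExactlyClasses G (6 + K)
  classification = classOf , classOf-surjective , λ a b → same-class⇒Equiv a b , Equiv⇒same-class

proposition2p45 : (k : ℕ) → 2 ≤ k → HasExactlyClasses (Dtilde (2 * k + 1)) (k + 4)
proposition2p45 (suc (suc K)) (s≤s (s≤s z≤n)) =
  subst₂ (λ n c → HasExactlyClasses (Dtilde n) c) (sym (size K)) (sym (count K)) (Classification.classification K)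
  where
  size : ∀ K → 2 * (2 + K) + 1 ≡ 5 + (K + K)
  size = ℕ-solve-∀
  count : ∀ K → 2 + K + 4 ≡ 6 + K
  count = ℕ-solve-∀
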